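{- If $\mathrm{Spec}$ is expressive for $\mathrm{Proc}$, then $\sqsubseteq \;=\; \boxminus$, i.e.\ the preorder $\sqsubseteq$ on models coincides with the equivalence $\boxminus$.
   Context: Let $\mathrm{Proc}$ be a set of models and $(\mathrm{Spec},\models)$ a specification formalism for it, where $\models\subseteq \mathrm{Proc}\times\mathrm{Spec}$. For $\mathcal I\in\mathrm{Proc}$, $\mathrm{Th}(\mathcal I)=\{\mathcal S\in\mathrm{Spec}\mid \mathcal I\models\mathcal S\}$. Define $\mathcal I_1\sqsubseteq\mathcal I_2$ iff $\mathrm{Th}(\mathcal I_1)\subseteq\mathrm{Th}(\mathcal I_2)$, and let $\boxminus=\sqsubseteq\cap\sqsupseteq$ (so $\mathcal I_1\boxminus\mathcal I_2$ iff $\mathrm{Th}(\mathcal I_1)=\mathrm{Th}(\mathcal I_2)$). A specification $\mathcal S$ is a characteristic formula for $\mathcal I$ if $\mathcal I\models\mathcal S$ and every $\mathcal I'\models\mathcal S$ satisfies $\mathcal I'\boxminus\mathcal I$. The formalism is expressive for $\mathrm{Proc}$ if every $\mathcal I\in\mathrm{Proc}$ has a characteristic formula. -}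

module Defs where

open import Level using (Level; _⊔_)
open import Data.Product using (_×_; Σ-syntax)

module Formalism {a b ℓ : Level} {Proc : Set a} {Spec : Set b}
                 (_⊨_ : Proc → Spec → Set ℓ) where

  Th : Proc → Spec → Set ℓ
  Th I S = I ⊨ S

  _⊑_ : Proc → Proc → Set (b ⊔ ℓ)
  I₁ ⊑ I₂ = ∀ S → Th I₁ S → Th I₂ S

  _⊟_ : Proc → Proc → Set (b ⊔ ℓ)
  I₁ ⊟ I₂ = (I₁ ⊑ I₂) × (I₂ ⊑ I₁)

  IsCharacteristic : Spec → Proc → Set (a ⊔ b ⊔ ℓ)
  IsCharacteristic S I = (I ⊨ S) × (∀ I′ → I′ ⊨ S → I′ ⊟ I)

  Expressive : Set (a ⊔ b ⊔ ℓ)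
  Expressive = ∀ I → Σ[ S ∈ Spec ] IsCharacteristic S I

-- A characteristic formula S of I₁ is in Th(I₁); if I₁ ⊑ I₂ then I₂ ⊨ S,
-- so I₂ ⊟ I₁, which supplies the missing inclusion I₂ ⊑ I₁.
module Submission where

open import Defs
open import Level using (Level)
open import Function.Bundles using (_⇔_; mk⇔)
open import Data.Product using (_,_; proj₁; proj₂)

module _ {a b ℓ : Level} {Proc : Set a} {Spec : Set b}
         (_⊨_ : Proc → Spec → Set ℓ) where

  open Formalism _⊨_

  characteristic⇒⊑-sym : ∀ {S I₁ I₂} → IsCharacteristic S I₁ → I₁ ⊑ I₂ → I₂ ⊑ I₁
  characteristic⇒⊑-sym {S} {I₂ = I₂} (I₁⊨S , char) I₁⊑I₂ =
    proj₁ (char I₂ (I₁⊑I₂ S I₁⊨S))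

  expressive⇒⊑⇔⊟ : Expressive → ∀ I₁ I₂ → I₁ ⊑ I₂ ⇔ I₁ ⊟ I₂
  expressive⇒⊑⇔⊟ expressive I₁ I₂ = mk⇔ ⊑⇒⊟ proj₁
    where
    ⊑⇒⊟ : I₁ ⊑ I₂ → I₁ ⊟ I₂
    ⊑⇒⊟ I₁⊑I₂ = I₁⊑I₂ , characteristic⇒⊑-sym (proj₂ (expressive I₁)) I₁⊑I₂

proposition1 : {a b ℓ : Level} {Proc : Set a} {Spec : Set b}
    (_⊨_ : Proc → Spec → Set ℓ) →
    Formalism.Expressive _⊨_ →
    ∀ I₁ I₂ → Formalism._⊑_ _⊨_ I₁ I₂ ⇔ Formalism._⊟_ _⊨_ I₁ I₂
proposition1 = expressive⇒⊑⇔⊟
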